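{- If $\mathcal{G}$ is provable in $\mathsf{LNGL}$, then $\mathcal{G}$ is valid.
   Context: Formulae are built from propositional atoms $p$ by $\neg$, $\lor$, $\Box$; a formula is valid iff it holds at every world of every Kripke model whose accessibility relation is transitive and conversely wellfounded (Gödel–Löb logic $\mathsf{GL}$). A linear nested sequent is an expression $\mathcal{G} = \Gamma_{1} \vdash \Delta_{1} \mathbin{/\!/} \cdots \mathbin{/\!/} \Gamma_{n} \vdash \Delta_{n}$ with $\Gamma_i,\Delta_i$ finite multisets of formulae. Its formula interpretation is $f(\Gamma \vdash \Delta) := \bigwedge \Gamma \rightarrow \bigvee \Delta$ and $f(\Gamma \vdash \Delta \mathbin{/\!/} \mathcal{G}) := \bigwedge \Gamma \rightarrow (\bigvee \Delta \lor \Box f(\mathcal{G}))$; $\mathcal{G}$ is valid iff $f(\mathcal{G})$ is valid. The calculus $\mathsf{LNGL}$ has the following rules, where $\mathcal{G}$ denotes a (possibly empty) initial segment of a linear nested sequent: initial sequents $\mathsf{id_1}$: $\mathcal{G} \mathbin{/\!/} \Gamma, p \vdash p, \Delta$ and $\mathsf{id_2}$: $\mathcal{G} \mathbin{/\!/} \Gamma, \Box\phi \vdash \Box\phi, \Delta$; $\lor\mathsf{L}$: from $\mathcal{G} \mathbin{/\!/} \Gamma, \phi \vdash \Delta$ and $\mathcal{G} \mathbin{/\!/} \Gamma, \psi \vdash \Delta$ infer $\mathcal{G} \mathbin{/\!/} \Gamma, \phi\lor\psi \vdash \Delta$; $\lor\mathsf{R}$: from $\mathcal{G} \mathbin{/\!/}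 \Gamma \vdash \phi,\psi,\Delta$ infer $\mathcal{G} \mathbin{/\!/} \Gamma \vdash \phi\lor\psi,\Delta$; $\neg\mathsf{L}$: from $\mathcal{G} \mathbin{/\!/} \Gamma \vdash \phi,\Delta$ infer $\mathcal{G} \mathbin{/\!/} \Gamma,\neg\phi \vdash \Delta$; $\neg\mathsf{R}$: from $\mathcal{G} \mathbin{/\!/} \Gamma,\phi \vdash \Delta$ infer $\mathcal{G} \mathbin{/\!/} \Gamma \vdash \neg\phi,\Delta$; $\mathsf{4L}$: from $\mathcal{G} \mathbin{/\!/} \Gamma,\Box\phi \vdash \Delta \mathbin{/\!/} \Sigma,\Box\phi \vdash \Pi$ infer $\mathcal{G} \mathbin{/\!/} \Gamma,\Box\phi \vdash \Delta \mathbin{/\!/} \Sigma \vdash \Pi$; $\Box\mathsf{L}$: from $\mathcal{G} \mathbin{/\!/} \Gamma,\Box\phi \vdash \Delta \mathbin{/\!/} \Sigma,\phi \vdash \Pi$ infer $\mathcal{G} \mathbin{/\!/} \Gamma,\Box\phi \vdash \Delta \mathbin{/\!/} \Sigma \vdash \Pi$; $\Box\mathsf{R}$: from $\mathcal{G} \mathbin{/\!/} \Gamma \vdash \Delta \mathbin{/\!/} \Box\phi \vdash \phi$ infer $\mathcal{G} \mathbin{/\!/} \Gamma \vdash \Box\phi,\Delta$. -}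

module Defs where

open import Data.Nat using (ℕ)
open import Data.Bool using (Bool; true)
open import Data.List using (List; []; _∷_; _∷ʳ_)
open import Data.List.Relation.Unary.All using (All)
open import Data.List.Relation.Binary.Permutation.Propositional using (_↭_)
open import Data.List.Relation.Binary.Pointwise using (Pointwise)
open import Data.Product using (_×_)
open import Relation.Nullary using (¬_)
open import Relation.Binary.PropositionalEquality using (_≡_)
open import Relation.Binary.Definitions using (Transitive)
open import Induction.WellFounded using (WellFounded)
open import Function using (flip)

infixr 6 _∨'_
infix 4 _⊢_

data Fm : Set where
  var  : ℕ → Fm
  ¬'   : Fm → Fm
  _∨'_ : Fm → Fm → Fm
  □    : Fm → Fm

-- A component Γ ⊢ Δ; multisets are lists, identified up to permutation
-- (see the structural rule `perm` below).
record Comp : Set where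
  constructor _⊢_
  field
    ant : List Fm
    suc : List Fm

CompPerm : Comp → Comp → Set
CompPerm (Γ ⊢ Δ) (Γ' ⊢ Δ') = (Γ ↭ Γ') × (Δ ↭ Δ')

-- A linear nested sequent G // C is represented as a pair of
-- a (possibly empty) list G of components and the last component C.
-- LNGL G C : the sequent G // C is derivable in LNGL.
data LNGL : List Comp → Comp → Set where
  id₁ : ∀ {G Γ Δ} p → LNGL G (var p ∷ Γ ⊢ var p ∷ Δ)
  id₂ : ∀ {G Γ Δ} φ → LNGL G (□ φ ∷ Γ ⊢ □ φ ∷ Δ)
  ∨L  : ∀ {G Γ Δ φ ψ} → LNGL G (φ ∷ Γ ⊢ Δ) → LNGL G (ψ ∷ Γ ⊢ Δ)
        → LNGL G ((φ ∨' ψ) ∷ Γ ⊢ Δ)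
  ∨R  : ∀ {G Γ Δ φ ψ} → LNGL G (Γ ⊢ φ ∷ ψ ∷ Δ) → LNGL G (Γ ⊢ (φ ∨' ψ) ∷ Δ)
  ¬L  : ∀ {G Γ Δ φ} → LNGL G (Γ ⊢ φ ∷ Δ) → LNGL G (¬' φ ∷ Γ ⊢ Δ)
  ¬R  : ∀ {G Γ Δ φ} → LNGL G (φ ∷ Γ ⊢ Δ) → LNGL G (Γ ⊢ ¬' φ ∷ Δ)
  4L  : ∀ {G Γ Δ Σ Π φ} → LNGL (G ∷ʳ (□ φ ∷ Γ ⊢ Δ)) (□ φ ∷ Σ ⊢ Π)
        → LNGL (G ∷ʳ (□ φ ∷ Γ ⊢ Δ)) (Σ ⊢ Π)
  □L  : ∀ {G Γ Δ Σ Π φ} → LNGL (G ∷ʳ (□ φ ∷ Γ ⊢ Δ)) (φ ∷ Σ ⊢ Π)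
        → LNGL (G ∷ʳ (□ φ ∷ Γ ⊢ Δ)) (Σ ⊢ Π)
  □R  : ∀ {G Γ Δ φ} → LNGL (G ∷ʳ (Γ ⊢ Δ)) (□ φ ∷ [] ⊢ φ ∷ [])
        → LNGL G (Γ ⊢ □ φ ∷ Δ)
  perm : ∀ {G G' C C'} → Pointwise CompPerm G G' → CompPerm C C'
        → LNGL G C → LNGL G' C'

record GLModel : Set₁ where
  field
    W     : Set
    R     : W → W → Set
    trans : Transitive R
    cwf   : WellFounded (flip R)
    V     : W → ℕ → Bool

module _ (M : GLModel) where
  open GLModel M

  -- Classical forcing relation (disjunction read classically, i.e. via ¬¬,
  -- so that every forcing statement is ¬¬-stable, as in classical semantics).
  _⊩_ : W → Fm → Set
  w ⊩ var p    = V w p ≡ true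
  w ⊩ ¬' φ     = ¬ (w ⊩ φ)
  w ⊩ (φ ∨' ψ) = ¬ ((¬ (w ⊩ φ)) × (¬ (w ⊩ ψ)))
  w ⊩ □ φ      = ∀ v → R w v → v ⊩ φ

  ⊩⋀ : W → List Fm → Set
  ⊩⋀ w Γ = All (w ⊩_) Γ

  -- "⋁Δ ∨ X" holds at w (classical disjunction; X = ⊥-like when absent)
  ⊩⋁∨ : W → List Fm → Set → Set
  ⊩⋁∨ w Δ X = ¬ (All (λ φ → ¬ (w ⊩ φ)) Δ × ¬ X)

  -- f(G // C) holds at w (formula interpretation, evaluated at w):
  --   f(Γ ⊢ Δ) = ⋀Γ → ⋁Δ ;  f(Γ ⊢ Δ // H) = ⋀Γ → (⋁Δ ∨ □ f(H))
  ⊩f : W → List Comp → Comp → Set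
  ⊩f w []            (Γ ⊢ Δ) = ⊩⋀ w Γ → ¬ All (λ φ → ¬ (w ⊩ φ)) Δ
  ⊩f w ((Γ ⊢ Δ) ∷ G) C       = ⊩⋀ w Γ → ⊩⋁∨ w Δ (∀ v → R w v → ⊩f v G C)

Valid : List Comp → Comp → Set₁
Valid G C = (M : GLModel) → (w : GLModel.W M) → ⊩f M w G C

{-# OPTIONS --safe #-}
-- Read with a hole in its last
-- component, the prefix G of a nested sequent G // C is a composite of operators
-- X ↦ (⋀Γ → ⋁Δ ∨ □X), each monotone, meet-preserving and true on a true argument.
-- Since every rule only changes the last one or two components, it therefore
-- suffices to check each rule locally at a single world. The GL-specific rules
-- need exactly the frame conditions: 4L uses transitivity, and □R uses Löb's
-- principle, proved by induction along the conversely wellfounded relation.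
module Submission where

open import Defs
open import Data.Bool using (true; false)
open import Data.Empty using (⊥-elim)
open import Data.List using (List; []; _∷_; _++_)
open import Data.List.Relation.Unary.All using ([]; _∷_)
open import Data.List.Relation.Binary.Pointwise using (Pointwise; []; _∷_)
open import Data.List.Relation.Binary.Permutation.Propositional using (↭-sym)
open import Data.List.Relation.Binary.Permutation.Propositional.Properties using (All-resp-↭)
open import Data.Product using (_,_)
open import Relation.Nullary.Negation.Core using (Stable)
open import Relation.Binary.PropositionalEquality using (refl)
open import Induction.WellFounded using (Acc; acc)

module Soundness (M : GLModel) where
  open GLModel M

  infix 4 _⊨_
  _⊨_ : W → Fm → Set
  _⊨_ = _⊩_ M

  ⊨-stable : ∀ w φ → Stable (w ⊨ φ)
  ⊨-stable w (var p) ¬¬p with V w p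
  ... | true  = refl
  ... | false = ⊥-elim (¬¬p λ ())
  ⊨-stable w (¬' φ)   ¬¬¬φ  wφ     = ¬¬¬φ (λ ¬φ → ¬φ wφ)
  ⊨-stable w (φ ∨' ψ) ¬¬φ∨ψ ¬φ×¬ψ  = ¬¬φ∨ψ (λ φ∨ψ → φ∨ψ ¬φ×¬ψ)
  ⊨-stable w (□ φ)    ¬¬□φ  v wRv  = ⊨-stable v φ (λ ¬φ → ¬¬□φ (λ □φ → ¬φ (□φ v wRv)))

  löb : ∀ {w φ} → (∀ v → R w v → v ⊨ □ φ → v ⊨ φ) → w ⊨ □ φ
  löb {w} {φ} step v wRv = below v (cwf v) wRv
    where
    below : ∀ v → Acc (λ x y → R y x) v → R w v → v ⊨ φ
    below v (acc rs) wRv = step v wRv (λ u vRu → below u (rs vRu) (trans wRv vRu))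

  ⊩⋁∨-map : ∀ {w Δ} {X Y : Set} → (X → Y) → ⊩⋁∨ M w Δ X → ⊩⋁∨ M w Δ Y
  ⊩⋁∨-map f h (¬Δ , ¬y) = h (¬Δ , λ x → ¬y (f x))

  ⊩⋁∨-zipWith : ∀ {w Δ} {X Y Z : Set} → (X → Y → Z)
              → ⊩⋁∨ M w Δ X → ⊩⋁∨ M w Δ Y → ⊩⋁∨ M w Δ Z
  ⊩⋁∨-zipWith f h₁ h₂ (¬Δ , ¬z) = h₁ (¬Δ , λ x → h₂ (¬Δ , λ y → ¬z (f x y)))

  ⊩comp : W → Comp → Set
  ⊩comp w C = ⊩f M w [] C

  ⊩// : W → Comp → (W → Set) → Set
  ⊩// w (Γ ⊢ Δ) P = ⊩⋀ M w Γ → ⊩⋁∨ M w Δ (∀ v → R w v → P v)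

  ⊩ctx : W → List Comp → (W → Set) → Set
  ⊩ctx w []      P = P w
  ⊩ctx w (c ∷ G) P = ⊩// w c (λ v → ⊩ctx v G P)

  ⊩//-map : ∀ {w} c {P Q : W → Set} → (∀ v → P v → Q v) → ⊩// w c P → ⊩// w c Q
  ⊩//-map c f h γ = ⊩⋁∨-map (λ □P v wRv → f v (□P v wRv)) (h γ)

  ⊩//-zipWith : ∀ {w} c {P Q S : W → Set} → (∀ v → P v → Q v → S v)
              → ⊩// w c P → ⊩// w c Q → ⊩// w c S
  ⊩//-zipWith c f h₁ h₂ γ =
    ⊩⋁∨-zipWith (λ □P □Q v wRv → f v (□P v wRv) (□Q v wRv)) (h₁ γ) (h₂ γ)

  ⊩//-pure : ∀ {w} c {P : W → Set} → (∀ v → P v) → ⊩// w c P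
  ⊩//-pure c p γ (¬Δ , ¬□P) = ¬□P (λ v _ → p v)

  ⊩//-resp-↭ : ∀ {w c c' P} → CompPerm c c' → ⊩// w c P → ⊩// w c' P
  ⊩//-resp-↭ (Γ↭Γ' , Δ↭Δ') h γ' (¬Δ' , ¬□P) =
    h (All-resp-↭ (↭-sym Γ↭Γ') γ') (All-resp-↭ (↭-sym Δ↭Δ') ¬Δ' , ¬□P)

  ⊩ctx→⊩f : ∀ {w} G {C} → ⊩ctx w G (λ v → ⊩comp v C) → ⊩f M w G C
  ⊩ctx→⊩f []      h = h
  ⊩ctx→⊩f (c ∷ G) h = ⊩//-map c (λ v → ⊩ctx→⊩f G) h

  ⊩ctx-map : ∀ {w} G {P Q : W → Set} → (∀ v → P v → Q v) → ⊩ctx w G P → ⊩ctx w G Q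
  ⊩ctx-map []      f h = f _ h
  ⊩ctx-map (c ∷ G) f   = ⊩//-map c (λ v → ⊩ctx-map G f)

  ⊩ctx-zipWith : ∀ {w} G {P Q S : W → Set} → (∀ v → P v → Q v → S v)
               → ⊩ctx w G P → ⊩ctx w G Q → ⊩ctx w G S
  ⊩ctx-zipWith []      f h₁ h₂ = f _ h₁ h₂
  ⊩ctx-zipWith (c ∷ G) f       = ⊩//-zipWith c (λ v → ⊩ctx-zipWith G f)

  ⊩ctx-pure : ∀ {w} G {P : W → Set} → (∀ v → P v) → ⊩ctx w G P
  ⊩ctx-pure []      p = p _
  ⊩ctx-pure (c ∷ G) p = ⊩//-pure c (λ v → ⊩ctx-pure G p)

  ⊩ctx-resp-↭ : ∀ {w G G'} {P Q : W → Set} → Pointwise CompPerm G G'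
              → (∀ v → P v → Q v) → ⊩ctx w G P → ⊩ctx w G' Q
  ⊩ctx-resp-↭ []                      f h = f _ h
  ⊩ctx-resp-↭ {G = c ∷ _} (c↭c' ∷ G↭G') f h =
    ⊩//-resp-↭ c↭c' (⊩//-map c (λ v → ⊩ctx-resp-↭ G↭G' f) h)

  ⊩ctx-++⁻ : ∀ {w} G H {P : W → Set} → ⊩ctx w (G ++ H) P → ⊩ctx w G (λ v → ⊩ctx v H P)
  ⊩ctx-++⁻ []      H h = h
  ⊩ctx-++⁻ (c ∷ G) H   = ⊩//-map c (λ v → ⊩ctx-++⁻ G H)

  ⊩ctx-++⁺ : ∀ {w} G H {P : W → Set} → ⊩ctx w G (λ v → ⊩ctx v H P) → ⊩ctx w (G ++ H) P
  ⊩ctx-++⁺ []      H h = h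
  ⊩ctx-++⁺ (c ∷ G) H   = ⊩//-map c (λ v → ⊩ctx-++⁺ G H)

  ⊩comp-resp-↭ : ∀ {w C C'} → CompPerm C C' → ⊩comp w C → ⊩comp w C'
  ⊩comp-resp-↭ (Γ↭Γ' , Δ↭Δ') h γ' ¬Δ' =
    h (All-resp-↭ (↭-sym Γ↭Γ') γ') (All-resp-↭ (↭-sym Δ↭Δ') ¬Δ')

  id-sound : ∀ {w φ Γ Δ} → ⊩comp w (φ ∷ Γ ⊢ φ ∷ Δ)
  id-sound (wφ ∷ _) (¬φ ∷ _) = ¬φ wφ

  ∨L-sound : ∀ {w φ ψ Γ Δ} → ⊩comp w (φ ∷ Γ ⊢ Δ) → ⊩comp w (ψ ∷ Γ ⊢ Δ)
           → ⊩comp w (φ ∨' ψ ∷ Γ ⊢ Δ)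
  ∨L-sound h₁ h₂ (φ∨ψ ∷ γ) ¬Δ = φ∨ψ ((λ wφ → h₁ (wφ ∷ γ) ¬Δ) , (λ wψ → h₂ (wψ ∷ γ) ¬Δ))

  ∨R-sound : ∀ {w φ ψ Γ Δ} → ⊩comp w (Γ ⊢ φ ∷ ψ ∷ Δ) → ⊩comp w (Γ ⊢ φ ∨' ψ ∷ Δ)
  ∨R-sound h γ (¬φ∨ψ ∷ ¬Δ) =
    h γ ((λ wφ → ¬φ∨ψ (λ (¬φ , _) → ¬φ wφ)) ∷ (λ wψ → ¬φ∨ψ (λ (_ , ¬ψ) → ¬ψ wψ)) ∷ ¬Δ)

  ¬L-sound : ∀ {w φ Γ Δ} → ⊩comp w (Γ ⊢ φ ∷ Δ) → ⊩comp w (¬' φ ∷ Γ ⊢ Δ)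
  ¬L-sound h (¬φ ∷ γ) ¬Δ = h γ (¬φ ∷ ¬Δ)

  ¬R-sound : ∀ {w φ Γ Δ} → ⊩comp w (φ ∷ Γ ⊢ Δ) → ⊩comp w (Γ ⊢ ¬' φ ∷ Δ)
  ¬R-sound h γ (¬¬φ ∷ ¬Δ) = ¬¬φ (λ wφ → h (wφ ∷ γ) ¬Δ)

  □-left-sound : ∀ {w φ ψ Γ Δ Σ Π} → (∀ v → R w v → w ⊨ □ φ → v ⊨ ψ)
               → ⊩// w (□ φ ∷ Γ ⊢ Δ) (λ v → ⊩comp v (ψ ∷ Σ ⊢ Π))
               → ⊩// w (□ φ ∷ Γ ⊢ Δ) (λ v → ⊩comp v (Σ ⊢ Π))
  □-left-sound ψ-below h (w□φ ∷ γ) =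
    ⊩⋁∨-map (λ k v wRv σ → k v wRv (ψ-below v wRv w□φ ∷ σ)) (h (w□φ ∷ γ))

  □L-sound : ∀ {w φ Γ Δ Σ Π}
           → ⊩// w (□ φ ∷ Γ ⊢ Δ) (λ v → ⊩comp v (φ ∷ Σ ⊢ Π))
           → ⊩// w (□ φ ∷ Γ ⊢ Δ) (λ v → ⊩comp v (Σ ⊢ Π))
  □L-sound = □-left-sound (λ v wRv w□φ → w□φ v wRv)

  4L-sound : ∀ {w φ Γ Δ Σ Π}
           → ⊩// w (□ φ ∷ Γ ⊢ Δ) (λ v → ⊩comp v (□ φ ∷ Σ ⊢ Π))
           → ⊩// w (□ φ ∷ Γ ⊢ Δ) (λ v → ⊩comp v (Σ ⊢ Π))
  4L-sound = □-left-sound (λ v wRv w□φ u vRu → w□φ u (trans wRv vRu))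

  □R-sound : ∀ {w φ Γ Δ} → ⊩// w (Γ ⊢ Δ) (λ v → ⊩comp v (□ φ ∷ [] ⊢ φ ∷ []))
           → ⊩comp w (Γ ⊢ □ φ ∷ Δ)
  □R-sound {φ = φ} h γ (¬□φ ∷ ¬Δ) =
    h γ (¬Δ , λ □prem → ¬□φ (löb (λ v wRv → □φ→φ v (□prem v wRv))))
    where
    □φ→φ : ∀ v → ⊩comp v (□ φ ∷ [] ⊢ φ ∷ []) → v ⊨ □ φ → v ⊨ φ
    □φ→φ v prem v□φ = ⊨-stable v φ (λ ¬φ → prem (v□φ ∷ []) (¬φ ∷ []))

  sound : ∀ {G C} → LNGL G C → ∀ w → ⊩ctx w G (λ v → ⊩comp v C)
  sound {G} (id₁ p)   w = ⊩ctx-pure G (λ v → id-sound)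
  sound {G} (id₂ φ)   w = ⊩ctx-pure G (λ v → id-sound)
  sound {G} (∨L d e)  w = ⊩ctx-zipWith G (λ v → ∨L-sound) (sound d w) (sound e w)
  sound {G} (∨R d)    w = ⊩ctx-map G (λ v → ∨R-sound) (sound d w)
  sound {G} (¬L d)    w = ⊩ctx-map G (λ v → ¬L-sound) (sound d w)
  sound {G} (¬R d)    w = ⊩ctx-map G (λ v → ¬R-sound) (sound d w)
  sound (4L {G} d)    w = ⊩ctx-++⁺ G _ (⊩ctx-map G (λ v → 4L-sound) (⊩ctx-++⁻ G _ (sound d w)))
  sound (□L {G} d)    w = ⊩ctx-++⁺ G _ (⊩ctx-map G (λ v → □L-sound) (⊩ctx-++⁻ G _ (sound d w)))
  sound {G} (□R d)    w = ⊩ctx-map G (λ v → □R-sound) (⊩ctx-++⁻ G _ (sound d w))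
  sound (perm G↭G' C↭C' d) w = ⊩ctx-resp-↭ G↭G' (λ v → ⊩comp-resp-↭ C↭C') (sound d w)

theorem4p1 : ∀ (G : List Comp) (C : Comp) → LNGL G C → Valid G C
theorem4p1 G C d M w = ⊩ctx→⊩f G (sound d w)
  where open Soundness M
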